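{- Let $S\subseteq \mathbb{N}^d$ be a generalized numerical semigroup and $\mathbf{f}\in H(S)$. Then $\mathbf{F}_{\prec}=\mathbf{f}$ for every relaxed monomial order $\prec$ on $\mathbb{N}^d$ if and only if $\mathbf{f}$ is the unique maximal element of $H(S)$ with respect to the natural partial order on $\mathbb{N}^d$.
   Context: A generalized numerical semigroup (GNS) is a submonoid $S\subseteq\mathbb{N}^d$ such that $H(S)=\mathbb{N}^d\setminus S$ is finite. Natural partial order: $\mathbf{x}\le\mathbf{y}$ iff $x^{(i)}\le y^{(i)}$ for all $i$. A relaxed monomial order is a total order $\prec$ on $\mathbb{N}^d$ such that (i) if $\mathbf{v}\prec\mathbf{w}$ then $\mathbf{v}\prec\mathbf{w}+\mathbf{u}$ for every $\mathbf{u}\in\mathbb{N}^d$, and (ii) $\mathbf{0}\prec\mathbf{v}$ for every nonzero $\mathbf{v}$. The Frobenius element of $S$ with respect to $\prec$, $\mathbf{F}_{\prec}$, is the largest element of $H(S)$ with respect to $\prec$. -}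

module Defs where

open import Level using (0ℓ)
open import Data.Nat using (ℕ; _+_; _≤_)
open import Data.Vec using (Vec; replicate; zipWith)
open import Data.Vec.Relation.Binary.Pointwise.Inductive using (Pointwise)
open import Data.List using (List)
open import Data.List.Membership.Propositional using (_∈_)
open import Data.Product using (Σ; _×_; ∃)
open import Data.Sum using (_⊎_)
open import Relation.Nullary using (¬_)
open import Relation.Binary.Core using (Rel)
open import Relation.Binary.Structures using (IsStrictTotalOrder)
open import Relation.Binary.PropositionalEquality using (_≡_; _≢_)
open import Function.Bundles using (_⇔_)

Pt : ℕ → Set
Pt d = Vec ℕ d

𝟎 : ∀ {d} → Pt d
𝟎 {d} = replicate d 0

_⊕_ : ∀ {d} → Pt d → Pt d → Pt d
_⊕_ = zipWith _+_

_≤ₙ_ : ∀ {d} → Pt d → Pt d → Set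
_≤ₙ_ = Pointwise _≤_

Subset : ℕ → Set₁
Subset d = Pt d → Set

H : ∀ {d} → Subset d → Subset d
H S x = ¬ S x

IsFinite : ∀ {d} → Subset d → Set
IsFinite {d} P = Σ (List (Pt d)) λ L → ∀ x → (x ∈ L ⇔ P x)

record IsGNS {d : ℕ} (S : Subset d) : Set where
  field
    zero∈ : S 𝟎
    closed : ∀ x y → S x → S y → S (x ⊕ y)
    finiteGaps : IsFinite (H S)

record IsRelaxedMonomialOrder {d : ℕ} (_≺_ : Rel (Pt d) 0ℓ) : Set where
  field
    isStrictTotalOrder : IsStrictTotalOrder _≡_ _≺_
    compat : ∀ v w u → v ≺ w → v ≺ (w ⊕ u)
    zero-least : ∀ v → v ≢ 𝟎 → 𝟎 ≺ v

IsFrobenius : ∀ {d} → Subset d → Rel (Pt d) 0ℓ → Pt d → Set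
IsFrobenius S _≺_ f = H S f × (∀ h → H S h → h ≡ f ⊎ h ≺ f)

IsMaximalIn : ∀ {d} → Subset d → Pt d → Set
IsMaximalIn P f = P f × (∀ h → P h → f ≤ₙ h → h ≡ f)

IsUniqueMaximalIn : ∀ {d} → Subset d → Pt d → Set
IsUniqueMaximalIn P f = IsMaximalIn P f × (∀ g → IsMaximalIn P g → g ≡ f)

module Submission where

-- Both sides are equivalent to "f is the greatest gap", i.e. h ≤ₙ f for all
-- gaps h.  The development, stated for an arbitrary subset P of ℕ^d:
--  * relaxed monomial orders refine ≤ₙ, since y = x ⊕ u forces ¬ (y ≺ x);
--    hence a ≤ₙ-greatest element of P is ≺-largest for every such order;
--  * relaxed monomial orders pull back along injective additive maps; the
--    lexicographic order is one, and pulling it back along v ↦ (vᵢ , v) gives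
--    an order ≺ᵢ that first compares the i-th coordinate.  If f is largest
--    for every ≺ᵢ, then no h ∈ P exceeds f in any coordinate, so f is greatest;
--  * a greatest element is the unique maximal one; conversely, in a finite P
--    every element lies below a maximal element (climb along ≤ₙ, which
--    strictly increases the coordinate sum, bounded on P), so a unique
--    maximal element is greatest.

open import Defs
open import Level using (0ℓ)
open import Data.Nat using (ℕ; zero; suc; _+_; _∸_; _≤_; _<_; _≤?_; _≟_; z≤n; z<s)
open import Data.Nat.Properties
open import Data.Nat.ListAction using () renaming (sum to sumList)
open import Data.Nat.Induction using (<-wellFounded)
open import Data.Fin using (Fin)
import Data.Fin as Fin
open import Data.Vec using ([]; _∷_; lookup; sum; tail)
open import Data.Vec.Properties using (≡-dec; lookup-zipWith; lookup-replicate)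
import Data.Vec.Relation.Binary.Pointwise.Inductive as PW
open PW using ([]; _∷_; Pointwise-≡⇒≡; ≡⇒Pointwise-≡)
import Data.Vec.Relation.Binary.Lex.Strict as Lex
open Lex using (Lex-<; this; next)
open import Data.List using (List; _∷_; map)
open import Data.List.Relation.Unary.Any using (here; there; any?)
open import Data.List.Membership.Propositional using (_∈_; find; lose)
open import Data.List.Membership.Propositional.Properties using (∈-map⁺)
open import Data.Product using (_×_; _,_; proj₁; proj₂; ∃)
open import Data.Sum using (_⊎_; inj₁; inj₂)
open import Data.Empty using (⊥-elim)
open import Function using (_∘_)
open import Induction.WellFounded using (Acc; acc)
open import Relation.Nullary using (¬_; yes; no)
open import Relation.Nullary.Decidable using (_×-dec_; ¬?)
open import Relation.Binary.Core using (Rel)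
open import Relation.Binary.Structures using (IsEquivalence; IsStrictTotalOrder)
open import Relation.Binary.Definitions using (Trichotomous; tri<; tri≈; tri>)
open import Relation.Binary.PropositionalEquality
open import Function.Bundles using (_⇔_; Equivalence; mk⇔)

_<ₗ_ : ∀ {n} → Rel (Pt n) 0ℓ
_<ₗ_ = Lex-< _≡_ _<_

-- The library proves it is a strict total order up to pointwise equality of
-- vectors, which coincides with propositional equality.
<ₗ-isStrictTotalOrder : ∀ {n} → IsStrictTotalOrder (_≡_ {A = Pt n}) _<ₗ_
<ₗ-isStrictTotalOrder = record
  { isStrictPartialOrder = record
    { isEquivalence = isEquivalence
    ; irrefl = Lex.<-irrefl <-irrefl ∘ ≡⇒Pointwise-≡
    ; trans = Lex.<-trans (IsEquivalence.isPartialEquivalence isEquivalence) <-resp₂-≡ <-trans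
    ; <-resp-≈ = resp₂ _<ₗ_ }
  ; compare = compare }
  where
  compare : ∀ {n} → Trichotomous (_≡_ {A = Pt n}) _<ₗ_
  compare v w with Lex.<-cmp sym <-cmp v w
  ... | tri< a b c = tri< a (b ∘ ≡⇒Pointwise-≡) c
  ... | tri≈ a b c = tri≈ a (Pointwise-≡⇒≡ b) c
  ... | tri> a b c = tri> a (b ∘ ≡⇒Pointwise-≡) c

<ₗ-compat : ∀ {n} (v w u : Pt n) → v <ₗ w → v <ₗ (w ⊕ u)
<ₗ-compat (x ∷ v) (y ∷ w) (k ∷ u) (this x<y refl) = this (≤-trans x<y (m≤m+n y k)) refl
<ₗ-compat (x ∷ v) (x ∷ w) (zero ∷ u) (next refl v<w) =
  next (sym (+-identityʳ x)) (<ₗ-compat v w u v<w)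
<ₗ-compat (x ∷ v) (x ∷ w) (suc k ∷ u) (next refl _) = this (m<m+n x z<s) refl

<ₗ-zero-least : ∀ {n} (v : Pt n) → v ≢ 𝟎 → 𝟎 <ₗ v
<ₗ-zero-least [] v≢𝟎 = ⊥-elim (v≢𝟎 refl)
<ₗ-zero-least (zero ∷ v) v≢𝟎 = next refl (<ₗ-zero-least v (v≢𝟎 ∘ cong (0 ∷_)))
<ₗ-zero-least (suc x ∷ v) _ = this z<s refl

<ₗ-isRelaxedMonomialOrder : ∀ {n} → IsRelaxedMonomialOrder (_<ₗ_ {n})
<ₗ-isRelaxedMonomialOrder = record
  { isStrictTotalOrder = <ₗ-isStrictTotalOrder
  ; compat = <ₗ-compat
  ; zero-least = <ₗ-zero-least }

pullback-isRelaxedMonomialOrder : ∀ {d m} {_≺_ : Rel (Pt m) 0ℓ} (φ : Pt d → Pt m) →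
  (∀ {v w} → φ v ≡ φ w → v ≡ w) → (∀ v w → φ (v ⊕ w) ≡ φ v ⊕ φ w) → φ 𝟎 ≡ 𝟎 →
  IsRelaxedMonomialOrder _≺_ → IsRelaxedMonomialOrder (λ v w → φ v ≺ φ w)
pullback-isRelaxedMonomialOrder {_≺_ = _≺_} φ φ-injective φ-⊕ φ-𝟎 R = record
  { isStrictTotalOrder = record
    { isStrictPartialOrder = record
      { isEquivalence = isEquivalence
      ; irrefl = O.irrefl ∘ cong φ
      ; trans = O.trans
      ; <-resp-≈ = resp₂ _ }
    ; compare = compare }
  ; compat = λ v w u φv≺φw → subst (φ v ≺_) (sym (φ-⊕ w u)) (R.compat (φ v) (φ w) (φ u) φv≺φw)
  ; zero-least = λ v v≢𝟎 → subst (_≺ φ v) (sym φ-𝟎)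
      (R.zero-least (φ v) (λ φv≡𝟎 → v≢𝟎 (φ-injective (trans φv≡𝟎 (sym φ-𝟎))))) }
  where
  module R = IsRelaxedMonomialOrder R
  module O = IsStrictTotalOrder R.isStrictTotalOrder
  compare : Trichotomous _≡_ (λ v w → φ v ≺ φ w)
  compare v w with O.compare (φ v) (φ w)
  ... | tri< a b c = tri< a (b ∘ cong φ) c
  ... | tri≈ a b c = tri≈ a (φ-injective b) c
  ... | tri> a b c = tri> a (b ∘ cong φ) c

_≺[_]_ : ∀ {d} → Pt d → Fin d → Pt d → Set
v ≺[ i ] w = (lookup v i ∷ v) <ₗ (lookup w i ∷ w)

≺[]-isRelaxedMonomialOrder : ∀ {d} (i : Fin d) → IsRelaxedMonomialOrder (_≺[ i ]_)
≺[]-isRelaxedMonomialOrder i = pullback-isRelaxedMonomialOrder (λ v → lookup v i ∷ v)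
  (cong tail)
  (λ v w → cong (_∷ (v ⊕ w)) (lookup-zipWith _+_ i v w))
  (cong (_∷ 𝟎) (lookup-replicate i 0))
  <ₗ-isRelaxedMonomialOrder

≤ₙ-refl : ∀ {n} {x : Pt n} → x ≤ₙ x
≤ₙ-refl = PW.refl ≤-refl

≤ₙ-trans : ∀ {n} {x y z : Pt n} → x ≤ₙ y → y ≤ₙ z → x ≤ₙ z
≤ₙ-trans = PW.trans ≤-trans

≤ₙ-antisym : ∀ {n} {x y : Pt n} → x ≤ₙ y → y ≤ₙ x → x ≡ y
≤ₙ-antisym [] [] = refl
≤ₙ-antisym (a≤b ∷ x≤y) (b≤a ∷ y≤x) = cong₂ _∷_ (≤-antisym a≤b b≤a) (≤ₙ-antisym x≤y y≤x)

≤ₙ⇒difference : ∀ {n} {x y : Pt n} → x ≤ₙ y → ∃ λ u → y ≡ x ⊕ u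
≤ₙ⇒difference [] = [] , refl
≤ₙ⇒difference {x = a ∷ _} {b ∷ _} (a≤b ∷ x≤y) with ≤ₙ⇒difference x≤y
... | u , y≡x⊕u = (b ∸ a) ∷ u , cong₂ _∷_ (sym (m+[n∸m]≡n a≤b)) y≡x⊕u

≰ₙ⇒coordinate : ∀ {n} (x y : Pt n) → ¬ (x ≤ₙ y) → ∃ λ i → lookup y i < lookup x i
≰ₙ⇒coordinate [] [] x≰y = ⊥-elim (x≰y [])
≰ₙ⇒coordinate (a ∷ x) (b ∷ y) x≰y with a ≤? b
... | no a≰b = Fin.zero , ≰⇒> a≰b
... | yes a≤b with ≰ₙ⇒coordinate x y (x≰y ∘ (a≤b ∷_))
...   | i , yᵢ<xᵢ = Fin.suc i , yᵢ<xᵢ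

-- Every relaxed monomial order refines the natural order: if x ≤ₙ y then
-- y = x ⊕ u, and y ≺ x would give y ≺ x ⊕ u = y.
relaxedMonomialOrder-refines-≤ₙ : ∀ {d} {_≺_ : Rel (Pt d) 0ℓ} → IsRelaxedMonomialOrder _≺_ →
  ∀ {x y} → x ≤ₙ y → ¬ (y ≺ x)
relaxedMonomialOrder-refines-≤ₙ {_≺_ = _≺_} R {x} {y} x≤y y≺x with ≤ₙ⇒difference x≤y
... | u , y≡x⊕u = IsStrictTotalOrder.irrefl (IsRelaxedMonomialOrder.isStrictTotalOrder R)
  refl (subst (y ≺_) (sym y≡x⊕u) (IsRelaxedMonomialOrder.compat R y x u y≺x))

IsGreatestIn : ∀ {d} → Subset d → Pt d → Set
IsGreatestIn P f = P f × (∀ h → P h → h ≤ₙ f)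

-- f is the ≺-largest element of P; IsFrobenius S ≺ f is IsLargestIn (H S) ≺ f.
IsLargestIn : ∀ {d} → Subset d → Rel (Pt d) 0ℓ → Pt d → Set
IsLargestIn P _≺_ f = P f × (∀ h → P h → h ≡ f ⊎ h ≺ f)

greatest⇒largest : ∀ {d} {P : Subset d} {_≺_ : Rel (Pt d) 0ℓ} {f} →
  IsRelaxedMonomialOrder _≺_ → IsGreatestIn P f → IsLargestIn P _≺_ f
greatest⇒largest {_≺_ = _≺_} {f} R (Pf , below) = Pf , λ h Ph → compareWith h (below h Ph)
  where
  compareWith : ∀ h → h ≤ₙ f → h ≡ f ⊎ h ≺ f
  compareWith h h≤f with IsStrictTotalOrder.compare (IsRelaxedMonomialOrder.isStrictTotalOrder R) h f
  ... | tri< h≺f _ _ = inj₂ h≺f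
  ... | tri≈ _ h≡f _ = inj₁ h≡f
  ... | tri> _ _ f≺h = ⊥-elim (relaxedMonomialOrder-refines-≤ₙ R h≤f f≺h)

-- If f is largest for each coordinate-first order ≺ᵢ, then f is greatest:
-- an h ∈ P with hᵢ > fᵢ would satisfy f ≺ᵢ h.
largestForCoordinateOrders⇒greatest : ∀ {d} {P : Subset d} {f} →
  P f → (∀ i → IsLargestIn P (_≺[ i ]_) f) → IsGreatestIn P f
largestForCoordinateOrders⇒greatest {P = P} {f} Pf largest = Pf , below
  where
  below : ∀ h → P h → h ≤ₙ f
  below h Ph with PW.decidable _≤?_ h f
  ... | yes h≤f = h≤f
  ... | no h≰f with ≰ₙ⇒coordinate h f h≰f
  ...   | i , fᵢ<hᵢ with proj₂ (largest i) h Ph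
  ...     | inj₁ refl = ⊥-elim (h≰f ≤ₙ-refl)
  ...     | inj₂ h≺f = ⊥-elim (IsStrictTotalOrder.asym
               (IsRelaxedMonomialOrder.isStrictTotalOrder (≺[]-isRelaxedMonomialOrder i))
               h≺f (this fᵢ<hᵢ refl))

greatest⇒uniqueMaximal : ∀ {d} {P : Subset d} {f} → IsGreatestIn P f → IsUniqueMaximalIn P f
greatest⇒uniqueMaximal {f = f} (Pf , below) =
  (Pf , λ h Ph f≤h → ≤ₙ-antisym (below h Ph) f≤h) ,
  λ g (Pg , maximal-g) → sym (maximal-g f Pf (below g Pg))

_<ₙ_ : ∀ {n} → Pt n → Pt n → Set
x <ₙ y = x ≤ₙ y × y ≢ x

sum-mono-≤ₙ : ∀ {n} {x y : Pt n} → x ≤ₙ y → sum x ≤ sum y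
sum-mono-≤ₙ [] = z≤n
sum-mono-≤ₙ (a≤b ∷ x≤y) = +-mono-≤ a≤b (sum-mono-≤ₙ x≤y)

sum-mono-<ₙ : ∀ {n} {x y : Pt n} → x <ₙ y → sum x < sum y
sum-mono-<ₙ ([] , y≢x) = ⊥-elim (y≢x refl)
sum-mono-<ₙ {x = a ∷ x} (a≤b ∷ x≤y , y≢x) with m≤n⇒m<n∨m≡n a≤b
... | inj₁ a<b = +-mono-<-≤ a<b (sum-mono-≤ₙ x≤y)
... | inj₂ refl = +-monoʳ-< a (sum-mono-<ₙ (x≤y , y≢x ∘ cong (a ∷_)))

∈⇒≤sumList : ∀ {n ns} → n ∈ ns → n ≤ sumList ns
∈⇒≤sumList (here refl) = m≤m+n _ _
∈⇒≤sumList {ns = m ∷ _} (there n∈ns) = ≤-trans (∈⇒≤sumList n∈ns) (m≤n+m _ m)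

module FiniteSubset {d} {P : Subset d} (finite : IsFinite P) where

  private
    elements : List (Pt d)
    elements = proj₁ finite

    membership : ∀ x → x ∈ elements ⇔ P x
    membership = proj₂ finite

  maximalOrDominated : ∀ h → P h → IsMaximalIn P h ⊎ ∃ λ h' → P h' × h <ₙ h'
  maximalOrDominated h Ph with any? (λ h' → PW.decidable _≤?_ h h' ×-dec ¬? (≡-dec _≟_ h' h)) elements
  ... | yes dominated with find dominated
  ...   | h' , h'∈ , h<h' = inj₂ (h' , Equivalence.to (membership h') h'∈ , h<h')
  maximalOrDominated h Ph | no ¬dominated = inj₁ (Ph , maximal)
    where
    maximal : ∀ h' → P h' → h ≤ₙ h' → h' ≡ h
    maximal h' Ph' h≤h' with ≡-dec _≟_ h' h
    ... | yes h'≡h = h'≡h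
    ... | no h'≢h = ⊥-elim (¬dominated (lose (Equivalence.from (membership h') Ph') (h≤h' , h'≢h)))

  -- Coordinate sums are bounded on P, so climbing strictly upwards decreases
  -- the distance of the sum to this bound.
  bound : ℕ
  bound = sumList (map sum elements)

  sum≤bound : ∀ {h} → P h → sum h ≤ bound
  sum≤bound {h} Ph = ∈⇒≤sumList (∈-map⁺ sum (Equivalence.from (membership h) Ph))

  climb-decreases : ∀ {h h'} → P h' → h <ₙ h' → bound ∸ sum h' < bound ∸ sum h
  climb-decreases Ph' h<h' = ∸-monoʳ-< (sum-mono-<ₙ h<h') (sum≤bound Ph')

  maximalAbove : ∀ h → P h → ∃ λ g → IsMaximalIn P g × h ≤ₙ g
  maximalAbove h Ph = climb h Ph (<-wellFounded (bound ∸ sum h))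
    where
    climb : ∀ h → P h → Acc _<_ (bound ∸ sum h) → ∃ λ g → IsMaximalIn P g × h ≤ₙ g
    climb h Ph (acc rec) with maximalOrDominated h Ph
    ... | inj₁ maximal = h , maximal , ≤ₙ-refl
    ... | inj₂ (h' , Ph' , h<h') with climb h' Ph' (rec (climb-decreases Ph' h<h'))
    ...   | g , maximal-g , h'≤g = g , maximal-g , ≤ₙ-trans (proj₁ h<h') h'≤g

uniqueMaximal⇒greatest : ∀ {d} {P : Subset d} {f} →
  IsFinite P → IsUniqueMaximalIn P f → IsGreatestIn P f
uniqueMaximal⇒greatest {P = P} {f} finite ((Pf , _) , unique) = Pf , below
  where
  below : ∀ h → P h → h ≤ₙ f
  below h Ph with FiniteSubset.maximalAbove finite h Ph
  ... | g , maximal-g , h≤g = subst (h ≤ₙ_) (unique g maximal-g) h≤g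

mainTheorem16 : (d : ℕ) (S : Subset d) → IsGNS S → (f : Pt d) → H S f →
    ((∀ (_≺_ : Rel (Pt d) 0ℓ) → IsRelaxedMonomialOrder _≺_ → IsFrobenius S _≺_ f)
    ⇔ IsUniqueMaximalIn (H S) f)
mainTheorem16 d S gns f f-gap = mk⇔ frobeniusForAll⇒uniqueMaximal uniqueMaximal⇒frobeniusForAll
  where
  frobeniusForAll⇒uniqueMaximal :
    (∀ (_≺_ : Rel (Pt d) 0ℓ) → IsRelaxedMonomialOrder _≺_ → IsFrobenius S _≺_ f) →
    IsUniqueMaximalIn (H S) f
  frobeniusForAll⇒uniqueMaximal frobenius = greatest⇒uniqueMaximal
    (largestForCoordinateOrders⇒greatest f-gap
      (λ i → frobenius (_≺[ i ]_) (≺[]-isRelaxedMonomialOrder i)))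

  uniqueMaximal⇒frobeniusForAll : IsUniqueMaximalIn (H S) f →
    ∀ (_≺_ : Rel (Pt d) 0ℓ) → IsRelaxedMonomialOrder _≺_ → IsFrobenius S _≺_ f
  uniqueMaximal⇒frobeniusForAll uniqueMaximal _≺_ R =
    greatest⇒largest R (uniqueMaximal⇒greatest (IsGNS.finiteGaps gns) uniqueMaximal)
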